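{- Let $a\in\mathbb{Z}_{\ge1}^n$, $b\in\mathbb{Z}^n$, $w\in\mathbb{Z}_{\ge0}^n$ and $w_0\in\mathbb{Z}_{\ge0}$ with $\sum_{i\le n}w_i/a_i\le w_0$. Then the problem \[ \min\Big\{w_0s+\sum_{i\le n}w_ix_i : s+a_ix_i\ge b_i\ \forall i\in\{1,\dots,n\},\ s\in\mathbb{Z}_{\ge0},\ x\in\mathbb{Z}^n\Big\} \] has an optimal solution $(s,x)$ with $s<\mathrm{lcm}_{i\le n}a_i$.
   Context: $\mathrm{lcm}_{i\le n}a_i$ is the least common multiple of $a_1,\dots,a_n$. -}

module Defs where

open import Data.Nat using (ℕ; zero; suc)
open import Data.Nat.LCM using (lcm)
open import Data.Fin using (Fin)
import Data.Integer as ℤ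
open import Data.Integer using (ℤ)
import Data.Rational as ℚ
open import Data.Rational using (ℚ)

lcmFin : (n : ℕ) → (Fin n → ℕ) → ℕ
lcmFin zero    a = 1
lcmFin (suc n) a = lcm (a Fin.zero) (lcmFin n (λ i → a (Fin.suc i)))
  where import Data.Fin as Fin

-- the rational number w / a ; the value at a = 0 is an irrelevant
-- convention (the theorem assumes a_i ≥ 1)
ratio : ℕ → ℕ → ℚ
ratio w zero    = ℚ.0ℚ
ratio w (suc k) = ℤ.+ w ℚ./ suc k

sumℚ : (n : ℕ) → (Fin n → ℚ) → ℚ
sumℚ zero    f = ℚ.0ℚ
sumℚ (suc n) f = f Fin.zero ℚ.+ sumℚ n (λ i → f (Fin.suc i))
  where import Data.Fin as Fin

sumℤ : (n : ℕ) → (Fin n → ℤ) → ℤ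
sumℤ zero    f = ℤ.+ 0
sumℤ (suc n) f = f Fin.zero ℤ.+ sumℤ n (λ i → f (Fin.suc i))
  where import Data.Fin as Fin

objective : (n : ℕ) → (w : Fin n → ℕ) → (w0 : ℕ) → (s : ℕ) → (x : Fin n → ℤ) → ℤ
objective n w w0 s x = ℤ.+ (w0 Data.Nat.* s) ℤ.+ sumℤ n (λ i → ℤ.+ (w i) ℤ.* x i)
  where import Data.Nat

Feasible : (n : ℕ) → (a : Fin n → ℕ) → (b : Fin n → ℤ) → (s : ℕ) → (x : Fin n → ℤ) → Set
Feasible n a b s x = ∀ i → b i ℤ.≤ ℤ.+ s ℤ.+ ℤ.+ (a i) ℤ.* x i

{-# OPTIONS --safe #-}

-- For fixed s the cheapest feasible x is coordinatewise, x_i = ⌈(b_i − s)/a_i⌉; call the resulting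
-- objective value v(s).  Write L = lcm a = c_i a_i.  Multiplying Σ w_i/a_i ≤ w0 by L gives
-- Σ w_i c_i ≤ w0 L, so if s = r + qL then (r, x + q c) is feasible whenever (s, x) is, and its
-- objective is smaller by q (w0 L − Σ w_i c_i) ≥ 0.  Hence v(s mod L) bounds every feasible
-- objective value, and a minimiser of v on [0, L) is a global optimum.

module Submission where

open import Data.Fin using (Fin; zero; suc)
open import Data.Integer as ℤ using (ℤ; +_; _+_; _*_; _-_; -_; _≤_; _<_)
open import Data.Integer.DivMod using (_/ℕ_; [n/ℕd]*d≤n; n<s[n/ℕd]*d)
open import Data.Integer.Properties
open import Data.Integer.Tactic.RingSolver using (solve; solve-∀)
open import Data.List using ([]; _∷_; upTo)
open import Data.List.Extrema ≤-totalOrder using (argmin; argmin-sel; f[argmin]≤f[xs])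
open import Data.List.Membership.Propositional.Properties using (∈-upTo⁺; ∈-upTo⁻)
open import Data.List.Relation.Unary.All using (lookup)
open import Data.Nat as ℕ using (ℕ; zero; suc; NonZero; _≥_)
import Data.Nat.DivMod as ℕ
import Data.Nat.Properties as ℕ
open import Data.Nat.Divisibility using (_∣_; ∣-trans)
open import Data.Nat.GCD using (gcd)
open import Data.Nat.LCM using (lcm; m∣lcm[m,n]; n∣lcm[m,n]; gcd*lcm)
open import Data.Product using (Σ; _×_; _,_; proj₁; proj₂)
open import Data.Rational as ℚ using (ℚ)
import Data.Rational.Properties as ℚ
open import Data.Rational.Unnormalised as ℚᵘ using (mkℚᵘ; *≡*)
import Data.Rational.Unnormalised.Properties as ℚᵘ
open import Data.Sum using (inj₁; inj₂)
open import Relation.Binary.PropositionalEquality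

open import Defs

-- The least solution is ⌈(b − u)/d⌉ = −⌊(u − b)/d⌋.
least-solution : ∀ (b u : ℤ) (d : ℕ) .{{_ : NonZero d}} →
                 Σ ℤ λ y → b ≤ u + + d * y × (∀ z → b ≤ u + + d * z → y ≤ z)
least-solution b u d = - q , feasible , least
  where
  q : ℤ
  q = (u - b) /ℕ d

  feasible : b ≤ u + + d * - q
  feasible = begin
    b                ≡⟨ solve (b ∷ u ∷ []) ⟩
    u - (u - b)      ≤⟨ +-monoʳ-≤ u (neg-mono-≤ ([n/ℕd]*d≤n (u - b) d)) ⟩
    u - q * + d      ≡⟨ cong (_+_ u) (trans (neg-distribˡ-* q (+ d)) (*-comm (- q) (+ d))) ⟩
    u + + d * - q    ∎
    where open ≤-Reasoning

  least : ∀ z → b ≤ u + + d * z → - q ≤ z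
  least z b≤u+dz = begin
    - q                    ≡⟨ suc-pred (- q) ⟨
    ℤ.suc (ℤ.pred (- q))   ≤⟨ i<j⇒suc[i]≤j (*-cancelˡ-<-nonNeg (+ d) d*pred[-q]<d*z) ⟩
    z                      ∎
    where
    open ≤-Reasoning
    distrib-pred-neg : ∀ d q → d * (ℤ.-1ℤ + - q) ≡ - ((ℤ.1ℤ + q) * d)
    distrib-pred-neg = solve-∀
    cancel : ∀ u k → u + k - u ≡ k
    cancel = solve-∀
    d*pred[-q]<d*z : + d * ℤ.pred (- q) < + d * z
    d*pred[-q]<d*z = begin-strict
      + d * ℤ.pred (- q)       ≡⟨ distrib-pred-neg (+ d) q ⟩
      - ((ℤ.1ℤ + q) * + d)     <⟨ neg-mono-< (n<s[n/ℕd]*d (u - b) d) ⟩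
      - (u - b)                ≡⟨ solve (u ∷ b ∷ []) ⟩
      b - u                    ≤⟨ +-monoˡ-≤ (- u) b≤u+dz ⟩
      u + + d * z - u          ≡⟨ cancel u (+ d * z) ⟩
      + d * z                  ∎

sumℤ-mono-≤ : ∀ n {f g : Fin n → ℤ} → (∀ i → f i ≤ g i) → sumℤ n f ≤ sumℤ n g
sumℤ-mono-≤ zero    f≤g = ≤-refl
sumℤ-mono-≤ (suc n) f≤g = +-mono-≤ (f≤g zero) (sumℤ-mono-≤ n (λ i → f≤g (suc i)))

sumℤ-linear : ∀ n (f g h : Fin n → ℤ) (k : ℤ) → (∀ i → h i ≡ f i + k * g i) →
              sumℤ n h ≡ sumℤ n f + k * sumℤ n g
sumℤ-linear zero    f g h k h≡ = sym (cong (_+_ (+ 0)) (*-zeroʳ k))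
sumℤ-linear (suc n) f g h k h≡ = begin
  h zero + sumℤ n (λ i → h (suc i))
    ≡⟨ cong₂ _+_ (h≡ zero) (sumℤ-linear n (λ i → f (suc i)) (λ i → g (suc i)) (λ i → h (suc i)) k (λ i → h≡ (suc i))) ⟩
  (f zero + k * g zero) + (sumℤ n (λ i → f (suc i)) + k * sumℤ n (λ i → g (suc i)))
    ≡⟨ interchange (f zero) (g zero) (sumℤ n (λ i → f (suc i))) (sumℤ n (λ i → g (suc i))) k ⟩
  (f zero + sumℤ n (λ i → f (suc i))) + k * (g zero + sumℤ n (λ i → g (suc i))) ∎
  where
  open ≡-Reasoning
  interchange : ∀ x y s t k → (x + k * y) + (s + k * t) ≡ (x + s) + k * (y + t)
  interchange = solve-∀

sumℚ-*-distribʳ : ∀ n (f : Fin n → ℚ) (r : ℚ) → sumℚ n f ℚ.* r ≡ sumℚ n (λ i → f i ℚ.* r)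
sumℚ-*-distribʳ zero    f r = ℚ.*-zeroˡ r
sumℚ-*-distribʳ (suc n) f r = trans (ℚ.*-distribʳ-+ r (f zero) _)
                                    (cong (ℚ._+_ (f zero ℚ.* r)) (sumℚ-*-distribʳ n (λ i → f (suc i)) r))

fromℤ : ℤ → ℚ
fromℤ k = k ℚ./ 1

toℚᵘ-fromℤ : ∀ k → ℚ.toℚᵘ (fromℤ k) ℚᵘ.≃ mkℚᵘ k 0
toℚᵘ-fromℤ k = ℚ.toℚᵘ-fromℚᵘ (mkℚᵘ k 0)

fromℤ-+ : ∀ i j → fromℤ (i + j) ≡ fromℤ i ℚ.+ fromℤ j
fromℤ-+ i j = ℚ.toℚᵘ-injective (begin
  ℚ.toℚᵘ (fromℤ (i + j))                ≈⟨ toℚᵘ-fromℤ (i + j) ⟩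
  mkℚᵘ (i + j) 0                        ≈⟨ *≡* (add-over-1 i j) ⟩
  mkℚᵘ i 0 ℚᵘ.+ mkℚᵘ j 0                ≈⟨ ℚᵘ.≃-sym (ℚᵘ.+-cong (toℚᵘ-fromℤ i) (toℚᵘ-fromℤ j)) ⟩
  ℚ.toℚᵘ (fromℤ i) ℚᵘ.+ ℚ.toℚᵘ (fromℤ j) ≈⟨ ℚᵘ.≃-sym (ℚ.toℚᵘ-homo-+ (fromℤ i) (fromℤ j)) ⟩
  ℚ.toℚᵘ (fromℤ i ℚ.+ fromℤ j)          ∎)
  where
  open ℚᵘ.≃-Reasoning
  add-over-1 : ∀ i j → (i + j) * ℤ.1ℤ ≡ (i * ℤ.1ℤ + j * ℤ.1ℤ) * ℤ.1ℤ
  add-over-1 = solve-∀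

fromℤ-* : ∀ i j → fromℤ (i * j) ≡ fromℤ i ℚ.* fromℤ j
fromℤ-* i j = ℚ.toℚᵘ-injective (begin
  ℚ.toℚᵘ (fromℤ (i * j))                ≈⟨ toℚᵘ-fromℤ (i * j) ⟩
  mkℚᵘ i 0 ℚᵘ.* mkℚᵘ j 0                ≈⟨ ℚᵘ.≃-sym (ℚᵘ.*-cong (toℚᵘ-fromℤ i) (toℚᵘ-fromℤ j)) ⟩
  ℚ.toℚᵘ (fromℤ i) ℚᵘ.* ℚ.toℚᵘ (fromℤ j) ≈⟨ ℚᵘ.≃-sym (ℚ.toℚᵘ-homo-* (fromℤ i) (fromℤ j)) ⟩
  ℚ.toℚᵘ (fromℤ i ℚ.* fromℤ j)          ∎)
  where open ℚᵘ.≃-Reasoning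

fromℤ-cancel-≤ : ∀ {i j} → fromℤ i ℚ.≤ fromℤ j → i ≤ j
fromℤ-cancel-≤ {i} {j} i≤j = subst₂ _≤_ (*-identityʳ i) (*-identityʳ j) (ℚᵘ.drop-*≤*
  (ℚᵘ.≤-respʳ-≃ (toℚᵘ-fromℤ j) (ℚᵘ.≤-respˡ-≃ (toℚᵘ-fromℤ i) (ℚ.toℚᵘ-mono-≤ i≤j))))

sumℚ-fromℤ : ∀ n (f : Fin n → ℚ) (g : Fin n → ℤ) → (∀ i → f i ≡ fromℤ (g i)) →
             sumℚ n f ≡ fromℤ (sumℤ n g)
sumℚ-fromℤ zero    f g f≡ = refl
sumℚ-fromℤ (suc n) f g f≡ = begin
  f zero ℚ.+ sumℚ n (λ i → f (suc i))
    ≡⟨ cong₂ ℚ._+_ (f≡ zero) (sumℚ-fromℤ n (λ i → f (suc i)) (λ i → g (suc i)) (λ i → f≡ (suc i))) ⟩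
  fromℤ (g zero) ℚ.+ fromℤ (sumℤ n (λ i → g (suc i)))
    ≡⟨ sym (fromℤ-+ (g zero) _) ⟩
  fromℤ (sumℤ (suc n) g) ∎
  where open ≡-Reasoning

ratio-*-fromℤ : ∀ w a c .{{_ : NonZero a}} → ratio w a ℚ.* fromℤ (+ (c ℕ.* a)) ≡ fromℤ (+ w * + c)
ratio-*-fromℤ w (suc k) c = ℚ.toℚᵘ-injective (begin
  ℚ.toℚᵘ (ratio w (suc k) ℚ.* fromℤ (+ (c ℕ.* suc k)))
    ≈⟨ ℚ.toℚᵘ-homo-* (ratio w (suc k)) _ ⟩
  ℚ.toℚᵘ (ratio w (suc k)) ℚᵘ.* ℚ.toℚᵘ (fromℤ (+ (c ℕ.* suc k)))
    ≈⟨ ℚᵘ.*-cong (ℚ.toℚᵘ-fromℚᵘ (mkℚᵘ (+ w) k)) (toℚᵘ-fromℤ _) ⟩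
  mkℚᵘ (+ w) k ℚᵘ.* mkℚᵘ (+ (c ℕ.* suc k)) 0
    ≈⟨ *≡* (trans (cong (λ m → (+ w * m) * ℤ.1ℤ) (pos-* c (suc k))) (reassoc (+ w) (+ c) (+ suc k))) ⟩
  mkℚᵘ (+ w * + c) 0
    ≈⟨ ℚᵘ.≃-sym (toℚᵘ-fromℤ _) ⟩
  ℚ.toℚᵘ (fromℤ (+ w * + c)) ∎)
  where
  open ℚᵘ.≃-Reasoning
  reassoc : ∀ w c d → (w * (c * d)) * ℤ.1ℤ ≡ (w * c) * (d * ℤ.1ℤ)
  reassoc = solve-∀

weighted-sum-bound : ∀ n (a w c : Fin n → ℕ) (w0 L : ℕ) → (∀ i → NonZero (a i)) →
                     (∀ i → L ≡ c i ℕ.* a i) →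
                     sumℚ n (λ i → ratio (w i) (a i)) ℚ.≤ fromℤ (+ w0) →
                     sumℤ n (λ i → + w i * + c i) ≤ + w0 * + L
weighted-sum-bound n a w c w0 L a≢0 L≡ Σw/a≤w0 = fromℤ-cancel-≤ (begin
  fromℤ (sumℤ n (λ i → + w i * + c i))
    ≡⟨ sym (sumℚ-fromℤ n _ _ term) ⟩
  sumℚ n (λ i → ratio (w i) (a i) ℚ.* fromℤ (+ L))
    ≡⟨ sym (sumℚ-*-distribʳ n _ (fromℤ (+ L))) ⟩
  sumℚ n (λ i → ratio (w i) (a i)) ℚ.* fromℤ (+ L)
    ≤⟨ ℚ.*-monoʳ-≤-nonNeg (fromℤ (+ L)) {{ℚ.normalize-nonNeg L 1}} Σw/a≤w0 ⟩
  fromℤ (+ w0) ℚ.* fromℤ (+ L)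
    ≡⟨ sym (fromℤ-* (+ w0) (+ L)) ⟩
  fromℤ (+ w0 * + L) ∎)
  where
  open ℚ.≤-Reasoning
  term : ∀ i → ratio (w i) (a i) ℚ.* fromℤ (+ L) ≡ fromℤ (+ w i * + c i)
  term i rewrite L≡ i = ratio-*-fromℤ (w i) (a i) (c i) {{a≢0 i}}

lcm-nonZero : ∀ m n .{{_ : NonZero m}} .{{_ : NonZero n}} → NonZero (lcm m n)
lcm-nonZero m n = ℕ.≢-nonZero λ lcm≡0 → ℕ.≢-nonZero⁻¹ (m ℕ.* n) {{ℕ.m*n≢0 m n}} (begin
  m ℕ.* n              ≡⟨ sym (gcd*lcm m n) ⟩
  gcd m n ℕ.* lcm m n  ≡⟨ cong (gcd m n ℕ.*_) lcm≡0 ⟩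
  gcd m n ℕ.* 0        ≡⟨ ℕ.*-zeroʳ (gcd m n) ⟩
  0                    ∎)
  where open ≡-Reasoning

lcmFin-nonZero : ∀ n (a : Fin n → ℕ) → (∀ i → NonZero (a i)) → NonZero (lcmFin n a)
lcmFin-nonZero zero    a a≢0 = _
lcmFin-nonZero (suc n) a a≢0 =
  lcm-nonZero (a zero) _ {{a≢0 zero}} {{lcmFin-nonZero n (λ i → a (suc i)) (λ i → a≢0 (suc i))}}

∣lcmFin : ∀ n (a : Fin n → ℕ) i → a i ∣ lcmFin n a
∣lcmFin (suc n) a zero    = m∣lcm[m,n] (a zero) _
∣lcmFin (suc n) a (suc i) = ∣-trans (∣lcmFin n (λ j → a (suc j)) i) (n∣lcm[m,n] (a zero) _)

minimiser-below : (f : ℕ → ℤ) (L : ℕ) .{{_ : NonZero L}} →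
                  Σ ℕ λ r → r ℕ.< L × (∀ r′ → r′ ℕ.< L → f r ≤ f r′)
minimiser-below f L = r , r<L , minimal
  where
  r : ℕ
  r = argmin f 0 (upTo L)

  r<L : r ℕ.< L
  r<L with argmin-sel f 0 (upTo L)
  ... | inj₁ r≡0 = subst (ℕ._< L) (sym r≡0) (ℕ.>-nonZero⁻¹ L)
  ... | inj₂ r∈  = ∈-upTo⁻ r∈

  minimal : ∀ r′ → r′ ℕ.< L → f r ≤ f r′
  minimal r′ r′<L = lookup (f[argmin]≤f[xs] {f = f} 0 (upTo L)) (∈-upTo⁺ r′<L)

pos-+-* : ∀ r q L → + (r ℕ.+ q ℕ.* L) ≡ + r + + q * + L
pos-+-* r q L = trans (pos-+ r (q ℕ.* L)) (cong (_+_ (+ r)) (pos-* q L))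

module Problem (n : ℕ) (a : Fin n → ℕ) (b : Fin n → ℤ) (w : Fin n → ℕ) (w0 : ℕ)
               (a≢0 : ∀ i → NonZero (a i)) where

  least-coordinate : ∀ s i → Σ ℤ λ y → b i ≤ + s + + a i * y × (∀ z → b i ≤ + s + + a i * z → y ≤ z)
  least-coordinate s i = least-solution (b i) (+ s) (a i) {{a≢0 i}}

  leastX : ℕ → Fin n → ℤ
  leastX s i = proj₁ (least-coordinate s i)

  leastX-feasible : ∀ s → Feasible n a b s (leastX s)
  leastX-feasible s i = proj₁ (proj₂ (least-coordinate s i))

  value : ℕ → ℤ
  value s = objective n w w0 s (leastX s)

  value-optimal : ∀ s x → Feasible n a b s x → value s ≤ objective n w w0 s x
  value-optimal s x feasible = +-monoʳ-≤ (+ (w0 ℕ.* s)) (sumℤ-mono-≤ n λ i →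
    *-monoˡ-≤-nonNeg (+ w i) (proj₂ (proj₂ (least-coordinate s i)) (x i) (feasible i)))

  module Period (L : ℕ) .{{_ : NonZero L}} (c : Fin n → ℕ) (L≡ : ∀ i → L ≡ c i ℕ.* a i)
                (weights≤w0 : sumℤ n (λ i → + w i * + c i) ≤ + w0 * + L) where

    shift : ℕ → (Fin n → ℤ) → Fin n → ℤ
    shift q x i = x i + + q * + c i

    shift-feasible : ∀ r q x → Feasible n a b (r ℕ.+ q ℕ.* L) x → Feasible n a b r (shift q x)
    shift-feasible r q x feasible i = ≤-trans (feasible i) (≤-reflexive (begin
      + (r ℕ.+ q ℕ.* L) + + a i * x i         ≡⟨ cong (_+ + a i * x i) (pos-+-* r q L) ⟩
      + r + + q * + L + + a i * x i           ≡⟨ cong (λ m → + r + + q * m + + a i * x i) L≡cᵢaᵢ ⟩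
      + r + + q * (+ c i * + a i) + + a i * x i ≡⟨ regroup (+ r) (+ q) (+ c i) (+ a i) (x i) ⟩
      + r + + a i * shift q x i               ∎))
      where
      open ≡-Reasoning
      L≡cᵢaᵢ : + L ≡ + c i * + a i
      L≡cᵢaᵢ = trans (cong +_ (L≡ i)) (pos-* (c i) (a i))
      regroup : ∀ r q c a x → r + q * (c * a) + a * x ≡ r + a * (x + q * c)
      regroup = solve-∀

    shift-objective : ∀ r q x → objective n w w0 r (shift q x) ≤ objective n w w0 (r ℕ.+ q ℕ.* L) x
    shift-objective r q x = begin
      objective n w w0 r (shift q x)
        ≡⟨ cong (_+_ (+ (w0 ℕ.* r))) (sumℤ-linear n _ _ _ (+ q) λ i → distrib (+ w i) (x i) (+ q) (+ c i)) ⟩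
      + (w0 ℕ.* r) + (S + + q * K)
        ≤⟨ +-monoʳ-≤ (+ (w0 ℕ.* r)) (+-monoʳ-≤ S (*-monoˡ-≤-nonNeg (+ q) weights≤w0)) ⟩
      + (w0 ℕ.* r) + (S + + q * (+ w0 * + L))
        ≡⟨ cong (_+ (S + + q * (+ w0 * + L))) (pos-* w0 r) ⟩
      + w0 * + r + (S + + q * (+ w0 * + L))
        ≡⟨ regroup (+ w0) (+ r) S (+ q) (+ L) ⟩
      + w0 * (+ r + + q * + L) + S
        ≡⟨ cong (_+ S) (sym (trans (pos-* w0 _) (cong (_*_ (+ w0)) (pos-+-* r q L)))) ⟩
      objective n w w0 (r ℕ.+ q ℕ.* L) x ∎
      where
      open ≤-Reasoning
      S K : ℤ
      S = sumℤ n (λ i → + w i * x i)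
      K = sumℤ n (λ i → + w i * + c i)
      distrib : ∀ w x q c → w * (x + q * c) ≡ w * x + q * (w * c)
      distrib = solve-∀
      regroup : ∀ w r S q L → w * r + (S + q * (w * L)) ≡ w * (r + q * L) + S
      regroup = solve-∀

    value-mod-optimal : ∀ s x → Feasible n a b s x → value (s ℕ.% L) ≤ objective n w w0 s x
    value-mod-optimal s x feasible = begin
      value r                            ≤⟨ value-optimal r (shift q x) (shift-feasible r q x feasible′) ⟩
      objective n w w0 r (shift q x)     ≤⟨ shift-objective r q x ⟩
      objective n w w0 (r ℕ.+ q ℕ.* L) x ≡⟨ cong (λ m → objective n w w0 m x) (sym s≡r+qL) ⟩
      objective n w w0 s x               ∎
      where
      open ≤-Reasoning
      r q : ℕ
      r = s ℕ.% L
      q = s ℕ./ L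
      s≡r+qL : s ≡ r ℕ.+ q ℕ.* L
      s≡r+qL = ℕ.m≡m%n+[m/n]*n s L
      feasible′ : Feasible n a b (r ℕ.+ q ℕ.* L) x
      feasible′ = subst (λ m → Feasible n a b m x) s≡r+qL feasible

mainTheorem19 : (n : ℕ) (a : Fin n → ℕ) (b : Fin n → ℤ) (w : Fin n → ℕ) (w0 : ℕ) →
    (∀ i → a i ≥ 1) →
    sumℚ n (λ i → ratio (w i) (a i)) ℚ.≤ (ℤ.+ w0 ℚ./ 1) →
    Σ ℕ (λ s → Σ (Fin n → ℤ) (λ x →
      Feasible n a b s x ×
      (∀ (s′ : ℕ) (x′ : Fin n → ℤ) → Feasible n a b s′ x′ →
        objective n w w0 s x ℤ.≤ objective n w w0 s′ x′) ×
      s ℕ.< lcmFin n a))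
mainTheorem19 n a b w w0 a≥1 Σw/a≤w0 = s , leastX s , leastX-feasible s , optimal , s<L
  where
  a≢0 : ∀ i → NonZero (a i)
  a≢0 i = ℕ.>-nonZero (a≥1 i)
  open Problem n a b w w0 a≢0

  L : ℕ
  L = lcmFin n a
  instance
    L≢0 : NonZero L
    L≢0 = lcmFin-nonZero n a a≢0
  c : Fin n → ℕ
  c i = _∣_.quotient (∣lcmFin n a i)
  L≡ : ∀ i → L ≡ c i ℕ.* a i
  L≡ i = _∣_.equality (∣lcmFin n a i)
  open Period L c L≡ (weighted-sum-bound n a w c w0 L a≢0 L≡ Σw/a≤w0)

  minimiser : Σ ℕ λ r → r ℕ.< L × (∀ r′ → r′ ℕ.< L → value r ≤ value r′)
  minimiser = minimiser-below value L
  s : ℕ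
  s = proj₁ minimiser
  s<L : s ℕ.< L
  s<L = proj₁ (proj₂ minimiser)

  optimal : ∀ s′ x′ → Feasible n a b s′ x′ → value s ≤ objective n w w0 s′ x′
  optimal s′ x′ feasible =
    ≤-trans (proj₂ (proj₂ minimiser) (s′ ℕ.% L) (ℕ.m%n<n s′ L)) (value-mod-optimal s′ x′ feasible)
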